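{- Let $\mathcal{K}$ be the 2-skeleton of the 24-cell in $\mathbb{R}^4$ with vertex set $\{\pm2e_i\}\cup\{(\pm1,\pm1,\pm1,\pm1)\}$. Let $F_{1,1,0,0}$ be its octahedral facet with vertices $(2,0,0,0)$, $(0,2,0,0)$, $(1,1,1,1)$, $(1,1,-1,1)$, $(1,1,-1,-1)$, $(1,1,1,-1)$. Orient the 12 edges of $F_{1,1,0,0}$ as follows: every edge at $(2,0,0,0)$ points away from $(2,0,0,0)$, every edge at $(0,2,0,0)$ points towards $(0,2,0,0)$, and the equatorial square is the directed cycle $(1,1,1,1)\to(1,1,-1,1)\to(1,1,-1,-1)\to(1,1,1,-1)\to(1,1,1,1)$. Let $G$ be the group of order 32 of linear maps of $\mathbb{R}^4$ generated by $(x_1,x_2,x_3,x_4)\mapsto(x_3,x_4,x_1,x_2)$ and $(x_1,x_2,x_3,x_4)\mapsto(-x_2,x_1,x_3,x_4)$. Orient every edge of the 24-cell as the image under an element $g\in G$ of an oriented edge of $F_{1,1,0,0}$. Then this orientation is well-defined (every edge is obtained this way and the resulting orientation does not depend on the choices), it is locally acyclic on $\mathcal{K}$ (acyclic on every triangle of the 24-cell), and it has no reversible edges.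
   Context: An edge of a locally acyclic orientation of the 1-skeleton of $\mathcal{K}$ is reversible if reversing only that edge yields again an orientation that is acyclic on every triangle of $\mathcal{K}$. -}

module Defs where

open import Data.Integer using (ℤ; +_; -_; _+_; _*_; _-_)
open import Data.Vec using (Vec; []; _∷_)
open import Data.List using (List; []; _∷_; _++_; map; concatMap)
open import Data.List.Membership.Propositional using (_∈_)
open import Data.Product using (_×_; _,_; ∃-syntax)
open import Data.Sum using (_⊎_)
open import Relation.Binary.PropositionalEquality using (_≡_)
open import Relation.Nullary using (¬_)

-- Points of ℤ⁴ ⊂ ℝ⁴ (all vertices have integer coordinates).
V : Set
V = Vec ℤ 4

pt : ℤ → ℤ → ℤ → ℤ → V
pt a b c d = a ∷ b ∷ c ∷ d ∷ []

p1 m1 p2 m2 z : ℤ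
p1 = + 1
m1 = - (+ 1)
p2 = + 2
m2 = - (+ 2)
z = + 0

signs : List ℤ
signs = p1 ∷ m1 ∷ []

vertexList : List V
vertexList =
  pt p2 z z z ∷ pt m2 z z z ∷ pt z p2 z z ∷ pt z m2 z z ∷
  pt z z p2 z ∷ pt z z m2 z ∷ pt z z z p2 ∷ pt z z z m2 ∷
  concatMap (λ a → concatMap (λ b → concatMap (λ c → map (λ d → pt a b c d) signs) signs) signs) signs

IsVertex : V → Set
IsVertex v = v ∈ vertexList

sq : ℤ → ℤ
sq x = x * x

dist2 : V → V → ℤ
dist2 (a ∷ b ∷ c ∷ d ∷ []) (a' ∷ b' ∷ c' ∷ d' ∷ []) =
  sq (a - a') + sq (b - b') + sq (c - c') + sq (d - d')

-- Edges of the 24-cell: pairs of vertices at (minimal) distance 2.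
Edge : V → V → Set
Edge u v = IsVertex u × IsVertex v × dist2 u v ≡ + 4

-- Triangles (2-faces) of the 24-cell = triples of pairwise adjacent vertices.
Triangle : V → V → V → Set
Triangle u v w = Edge u v × Edge v w × Edge u w

data Gen : Set where
  σ ρ : Gen

act : Gen → V → V
act σ (a ∷ b ∷ c ∷ d ∷ []) = c ∷ d ∷ a ∷ b ∷ []
act ρ (a ∷ b ∷ c ∷ d ∷ []) = (- b) ∷ a ∷ c ∷ d ∷ []

-- Elements of G = words in the generators (G is finite, so the
-- generated group equals the set of all finite products of generators).
apply : List Gen → V → V
apply [] v = v
apply (g ∷ w) v = act g (apply w v)

A B s1 s2 s3 s4 : V
A  = pt p2 z z z
B  = pt z p2 z z
s1 = pt p1 p1 p1 p1
s2 = pt p1 p1 m1 p1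
s3 = pt p1 p1 m1 m1
s4 = pt p1 p1 p1 m1

FEdgeList : List (V × V)
FEdgeList =
  (A , s1) ∷ (A , s2) ∷ (A , s3) ∷ (A , s4) ∷
  (s1 , B) ∷ (s2 , B) ∷ (s3 , B) ∷ (s4 , B) ∷
  (s1 , s2) ∷ (s2 , s3) ∷ (s3 , s4) ∷ (s4 , s1) ∷ []

FEdge : V → V → Set
FEdge a b = (a , b) ∈ FEdgeList

Orient : V → V → Set
Orient u v = ∃[ w ] ∃[ a ] ∃[ b ] (FEdge a b × apply w a ≡ u × apply w b ≡ v)

WellDefined : (V → V → Set) → Set
WellDefined O =
  (∀ u v → O u v → Edge u v) ×
  (∀ u v → Edge u v → O u v ⊎ O v u) ×
  (∀ u v → O u v → ¬ O v u)

LocallyAcyclic : (V → V → Set) → Set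
LocallyAcyclic O = ∀ u v w → Triangle u v w → ¬ (O u v × O v w × O w u)

Reverse : (V → V → Set) → V → V → (V → V → Set)
Reverse O x y u v = (O u v × ¬ (u ≡ x × v ≡ y)) ⊎ (u ≡ y × v ≡ x)

Reversible : (V → V → Set) → V → V → Set
Reversible O x y = O x y × LocallyAcyclic (Reverse O x y)

-- The orientation is G-invariant, hence it is the G-orbit of the twelve oriented edges
-- of F₁₁₀₀. That orbit consists of 96 arcs, four leaving each vertex; once it is listed
-- explicitly, it is identified with the orientation by checking that it contains the
-- facet arcs, is closed under both generators, and consists of images of facet arcs.
-- Everything else is then a finite check on 24 vertices and 96 arcs. No edge x → y is
-- reversible because it is always the long side of a transitive triangle x → w → y,
-- which the reversal turns into a directed 3-cycle.
module Submission where

open import Defs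
open import Data.Integer as ℤ using (ℤ; +_; _-_; _*_)
open import Data.Integer.Tactic.RingSolver using (solve-∀)
open import Data.Nat using (ℕ)
open import Data.List using (List; []; _∷_; [_]; _++_; map; concat; concatMap; replicate; upTo)
open import Data.List.Relation.Unary.All as All using (All; all?)
open import Data.List.Relation.Unary.Any using (Any; any?; satisfied)
open import Data.List.Membership.Propositional using (_∈_; _∉_; find)
open import Data.Product using (_×_; _,_; proj₁; proj₂; ∃-syntax)
open import Data.Product.Properties using (≡-dec)
open import Data.Sum using (_⊎_; inj₁; inj₂)
open import Data.Vec using ([]; _∷_)
import Data.Vec.Properties as Vec
open import Relation.Binary.Definitions using (DecidableEquality)
open import Relation.Binary.PropositionalEquality using (_≡_; refl; sym; trans)
open import Relation.Nullary using (¬_; Dec)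
open import Relation.Nullary.Decidable using (from-yes; _×-dec_; _⊎-dec_; _→-dec_)

_≟ᵥ_ : DecidableEquality V
_≟ᵥ_ = Vec.≡-dec ℤ._≟_

_≟ₐ_ : DecidableEquality (V × V)
_≟ₐ_ = ≡-dec _≟ᵥ_ _≟ᵥ_

open import Data.List.Membership.DecPropositional _≟ᵥ_ using () renaming (_∈?_ to _∈ᵥ?_)
open import Data.List.Membership.DecPropositional _≟ₐ_ using (_∈?_; _∉?_)

sq-sub-comm : ∀ a b → (a - b) * (a - b) ≡ (b - a) * (b - a)
sq-sub-comm = solve-∀

sq-sub-self : ∀ a → (a - a) * (a - a) ≡ + 0
sq-sub-self = solve-∀

dist2-sym : ∀ u v → dist2 u v ≡ dist2 v u
dist2-sym (a ∷ b ∷ c ∷ d ∷ []) (a′ ∷ b′ ∷ c′ ∷ d′ ∷ [])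
  rewrite sq-sub-comm a a′ | sq-sub-comm b b′ | sq-sub-comm c c′ | sq-sub-comm d d′ = refl

dist2-self : ∀ v → dist2 v v ≡ + 0
dist2-self (a ∷ b ∷ c ∷ d ∷ [])
  rewrite sq-sub-self a | sq-sub-self b | sq-sub-self c | sq-sub-self d = refl

Edge-sym : ∀ {u v} → Edge u v → Edge v u
Edge-sym {u} {v} (u∈ , v∈ , d) = v∈ , u∈ , trans (dist2-sym v u) d

Edge-irrefl : ∀ {v} → ¬ Edge v v
Edge-irrefl {v} (_ , _ , d) with trans (sym (dist2-self v)) d
... | ()

edge? : ∀ u v → Dec (Edge u v)
edge? u v = u ∈ᵥ? vertexList ×-dec v ∈ᵥ? vertexList ×-dec dist2 u v ℤ.≟ + 4

transitive-triangle⇒¬Reversible :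
  {O : V → V → Set} → (∀ {u v} → O u v → Edge u v) →
  ∀ {x y w} → O x w → O w y → ¬ Reversible O x y
transitive-triangle⇒¬Reversible edge oxw owy (oxy , acyclic) =
  acyclic _ _ _ (Edge-sym (edge oxy) , edge oxw , Edge-sym (edge owy))
    ( inj₂ (refl , refl)
    , inj₁ (oxw , λ { (_ , refl) → Edge-irrefl (edge owy) })
    , inj₁ (owy , λ { (refl , _) → Edge-irrefl (edge oxw) }))

actₐ : Gen → V × V → V × V
actₐ g (a , b) = act g a , act g b

applyₐ : List Gen → V × V → V × V
applyₐ w (a , b) = apply w a , apply w b

module _ {L : List (V × V)} (act-closed : ∀ g {e} → e ∈ L → actₐ g e ∈ L) where

  applyₐ-closed : ∀ w {e} → e ∈ L → applyₐ w e ∈ L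
  applyₐ-closed []      e∈L = e∈L
  applyₐ-closed (g ∷ w) e∈L = act-closed g (applyₐ-closed w e∈L)

  Orient⇒∈ : All (_∈ L) FEdgeList → ∀ {u v} → Orient u v → (u , v) ∈ L
  Orient⇒∈ facet⊆L (w , _ , _ , f∈F , refl , refl) = applyₐ-closed w (All.lookup facet⊆L f∈F)

_^_ : List Gen → ℕ → List Gen
w ^ n = concat (replicate n w)

-- G = ⟨ρ⟩ × ⟨τ⟩ ⋊ ⟨σ⟩ with τ = σρσ, so its elements are the words ρⁱ τʲ σᵏ.
groupWords : List (List Gen)
groupWords =
  concatMap (λ i → concatMap (λ j → map (λ k → [ ρ ] ^ i ++ (σ ∷ ρ ∷ σ ∷ []) ^ j ++ [ σ ] ^ k)
    (upTo 2)) (upTo 4)) (upTo 4)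

FacetImage : V × V → Set
FacetImage e = Any (λ w → Any (λ f → applyₐ w f ≡ e) FEdgeList) groupWords

facetImage? : ∀ e → Dec (FacetImage e)
facetImage? e = any? (λ w → any? (λ f → applyₐ w f ≟ₐ e) FEdgeList) groupWords

FacetImage⇒Orient : ∀ {u v} → FacetImage (u , v) → Orient u v
FacetImage⇒Orient image with satisfied image
... | w , image-of-w with find image-of-w
...   | (a , b) , ab∈F , refl = w , a , b , ab∈F , refl , refl

successors : List (V × List V)
successors =
  (pt p2 z z z , pt p1 p1 m1 m1 ∷ pt p1 p1 m1 p1 ∷ pt p1 p1 p1 m1 ∷ pt p1 p1 p1 p1 ∷ []) ∷
  (pt m2 z z z , pt m1 m1 m1 m1 ∷ pt m1 m1 m1 p1 ∷ pt m1 m1 p1 m1 ∷ pt m1 m1 p1 p1 ∷ []) ∷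
  (pt z p2 z z , pt m1 p1 m1 m1 ∷ pt m1 p1 m1 p1 ∷ pt m1 p1 p1 m1 ∷ pt m1 p1 p1 p1 ∷ []) ∷
  (pt z m2 z z , pt p1 m1 m1 m1 ∷ pt p1 m1 m1 p1 ∷ pt p1 m1 p1 m1 ∷ pt p1 m1 p1 p1 ∷ []) ∷
  (pt z z p2 z , pt m1 m1 p1 p1 ∷ pt m1 p1 p1 p1 ∷ pt p1 m1 p1 p1 ∷ pt p1 p1 p1 p1 ∷ []) ∷
  (pt z z m2 z , pt m1 m1 m1 m1 ∷ pt m1 p1 m1 m1 ∷ pt p1 m1 m1 m1 ∷ pt p1 p1 m1 m1 ∷ []) ∷
  (pt z z z p2 , pt m1 m1 m1 p1 ∷ pt m1 p1 m1 p1 ∷ pt p1 m1 m1 p1 ∷ pt p1 p1 m1 p1 ∷ []) ∷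
  (pt z z z m2 , pt m1 m1 p1 m1 ∷ pt m1 p1 p1 m1 ∷ pt p1 m1 p1 m1 ∷ pt p1 p1 p1 m1 ∷ []) ∷
  (pt p1 p1 p1 p1 , pt m1 p1 p1 p1 ∷ pt z z z p2 ∷ pt z p2 z z ∷ pt p1 p1 m1 p1 ∷ []) ∷
  (pt p1 p1 p1 m1 , pt m1 p1 p1 m1 ∷ pt z z p2 z ∷ pt z p2 z z ∷ pt p1 p1 p1 p1 ∷ []) ∷
  (pt p1 p1 m1 p1 , pt m1 p1 m1 p1 ∷ pt z z m2 z ∷ pt z p2 z z ∷ pt p1 p1 m1 m1 ∷ []) ∷
  (pt p1 p1 m1 m1 , pt m1 p1 m1 m1 ∷ pt z z z m2 ∷ pt z p2 z z ∷ pt p1 p1 p1 m1 ∷ []) ∷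
  (pt p1 m1 p1 p1 , pt z z z p2 ∷ pt p1 m1 m1 p1 ∷ pt p1 p1 p1 p1 ∷ pt p2 z z z ∷ []) ∷
  (pt p1 m1 p1 m1 , pt z z p2 z ∷ pt p1 m1 p1 p1 ∷ pt p1 p1 p1 m1 ∷ pt p2 z z z ∷ []) ∷
  (pt p1 m1 m1 p1 , pt z z m2 z ∷ pt p1 m1 m1 m1 ∷ pt p1 p1 m1 p1 ∷ pt p2 z z z ∷ []) ∷
  (pt p1 m1 m1 m1 , pt z z z m2 ∷ pt p1 m1 p1 m1 ∷ pt p1 p1 m1 m1 ∷ pt p2 z z z ∷ []) ∷
  (pt m1 p1 p1 p1 , pt m2 z z z ∷ pt m1 m1 p1 p1 ∷ pt m1 p1 m1 p1 ∷ pt z z z p2 ∷ []) ∷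
  (pt m1 p1 p1 m1 , pt m2 z z z ∷ pt m1 m1 p1 m1 ∷ pt m1 p1 p1 p1 ∷ pt z z p2 z ∷ []) ∷
  (pt m1 p1 m1 p1 , pt m2 z z z ∷ pt m1 m1 m1 p1 ∷ pt m1 p1 m1 m1 ∷ pt z z m2 z ∷ []) ∷
  (pt m1 p1 m1 m1 , pt m2 z z z ∷ pt m1 m1 m1 m1 ∷ pt m1 p1 p1 m1 ∷ pt z z z m2 ∷ []) ∷
  (pt m1 m1 p1 p1 , pt m1 m1 m1 p1 ∷ pt z m2 z z ∷ pt z z z p2 ∷ pt p1 m1 p1 p1 ∷ []) ∷
  (pt m1 m1 p1 m1 , pt m1 m1 p1 p1 ∷ pt z m2 z z ∷ pt z z p2 z ∷ pt p1 m1 p1 m1 ∷ []) ∷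
  (pt m1 m1 m1 p1 , pt m1 m1 m1 m1 ∷ pt z m2 z z ∷ pt z z m2 z ∷ pt p1 m1 m1 p1 ∷ []) ∷
  (pt m1 m1 m1 m1 , pt m1 m1 p1 m1 ∷ pt z m2 z z ∷ pt z z z m2 ∷ pt p1 m1 m1 m1 ∷ []) ∷
  []

orbit : List (V × V)
orbit = concatMap (λ (u , vs) → map (u ,_) vs) successors

-- Opaque so that later uses do not unfold, and thereby re-evaluate, the decision procedures.
opaque
  facet⊆orbit : All (_∈ orbit) FEdgeList
  facet⊆orbit = from-yes (all? (_∈? orbit) FEdgeList)

  orbit-act-closed : All (λ e → actₐ σ e ∈ orbit × actₐ ρ e ∈ orbit) orbit
  orbit-act-closed = from-yes (all? (λ e → actₐ σ e ∈? orbit ×-dec actₐ ρ e ∈? orbit) orbit)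

  orbit-facetImages : All FacetImage orbit
  orbit-facetImages = from-yes (all? facetImage? orbit)

  orbit-edges : All (λ (u , v) → Edge u v) orbit
  orbit-edges = from-yes (all? (λ (u , v) → edge? u v) orbit)

  edges-in-orbit :
    All (λ u → All (λ v → dist2 u v ≡ + 4 → (u , v) ∈ orbit ⊎ (v , u) ∈ orbit) vertexList) vertexList
  edges-in-orbit = from-yes (all? (λ u → all? (λ v →
    dist2 u v ℤ.≟ + 4 →-dec ((u , v) ∈? orbit ⊎-dec (v , u) ∈? orbit)) vertexList) vertexList)

  orbit-asym : All (λ (u , v) → (v , u) ∉ orbit) orbit
  orbit-asym = from-yes (all? (λ (u , v) → (v , u) ∉? orbit) orbit)

  orbit-no-3-cycle : All (λ (u , v) → All (λ (v′ , w) → v ≡ v′ → (w , u) ∉ orbit) orbit) orbit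
  orbit-no-3-cycle = from-yes (all? (λ (u , v) → all? (λ (v′ , w) →
    v ≟ᵥ v′ →-dec (w , u) ∉? orbit) orbit) orbit)

  orbit-shortcuts : All (λ (x , y) → Any (λ w → (x , w) ∈ orbit × (w , y) ∈ orbit) vertexList) orbit
  orbit-shortcuts = from-yes (all? (λ (x , y) → any? (λ w →
    (x , w) ∈? orbit ×-dec (w , y) ∈? orbit) vertexList) orbit)

Orient⇒∈orbit : ∀ {u v} → Orient u v → (u , v) ∈ orbit
Orient⇒∈orbit = Orient⇒∈ closed facet⊆orbit
  where
    closed : ∀ g {e} → e ∈ orbit → actₐ g e ∈ orbit
    closed σ e∈ = proj₁ (All.lookup orbit-act-closed e∈)
    closed ρ e∈ = proj₂ (All.lookup orbit-act-closed e∈)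

∈orbit⇒Orient : ∀ {u v} → (u , v) ∈ orbit → Orient u v
∈orbit⇒Orient e∈ = FacetImage⇒Orient (All.lookup orbit-facetImages e∈)

Orient⇒Edge : ∀ {u v} → Orient u v → Edge u v
Orient⇒Edge o = All.lookup orbit-edges (Orient⇒∈orbit o)

Edge⇒Orient : ∀ {u v} → Edge u v → Orient u v ⊎ Orient v u
Edge⇒Orient (u∈ , v∈ , d) with All.lookup (All.lookup edges-in-orbit u∈) v∈ d
... | inj₁ uv∈ = inj₁ (∈orbit⇒Orient uv∈)
... | inj₂ vu∈ = inj₂ (∈orbit⇒Orient vu∈)

Orient-asym : ∀ {u v} → Orient u v → ¬ Orient v u
Orient-asym o o′ = All.lookup orbit-asym (Orient⇒∈orbit o) (Orient⇒∈orbit o′)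

Orient-no-3-cycle : ∀ {u v w} → ¬ (Orient u v × Orient v w × Orient w u)
Orient-no-3-cycle (o₁ , o₂ , o₃) =
  All.lookup (All.lookup orbit-no-3-cycle (Orient⇒∈orbit o₁)) (Orient⇒∈orbit o₂) refl (Orient⇒∈orbit o₃)

Orient-shortcut : ∀ {x y} → Orient x y → ∃[ w ] (Orient x w × Orient w y)
Orient-shortcut o with satisfied (All.lookup orbit-shortcuts (Orient⇒∈orbit o))
... | w , xw∈ , wy∈ = w , ∈orbit⇒Orient xw∈ , ∈orbit⇒Orient wy∈

Orient-not-reversible : ∀ {x y} → ¬ Reversible Orient x y
Orient-not-reversible rev@(o , _) =
  let _ , oxw , owy = Orient-shortcut o in transitive-triangle⇒¬Reversible Orient⇒Edge oxw owy rev

lemma2p2 : WellDefined Orient × LocallyAcyclic Orient × (∀ x y → ¬ Reversible Orient x y)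
lemma2p2 =
  ( (λ _ _ → Orient⇒Edge) , (λ _ _ → Edge⇒Orient) , (λ _ _ → Orient-asym) )
  , (λ _ _ _ _ → Orient-no-3-cycle)
  , (λ _ _ → Orient-not-reversible)
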